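{- Let $X$ be a $(95,40,12,20)$ strongly regular graph and let $K$ be a $4$-clique of $X$ that is not contained in any $5$-clique of $X$. For $i\in\{0,1,2,3\}$ let $X_i$ be the set of vertices of $V(X)\setminus V(K)$ having exactly $i$ neighbours in $K$, and suppose $(|X_0|,|X_1|,|X_2|,|X_3|)=(0,37,51,3)$. Write $X_3=\{x_0,x_1,x_2\}$ and for $i\in\{0,1,2\}$ let $X_2^i$ be the set of neighbours of $x_i$ in $X_2$. Then $|X_2^0\cap X_2^1|,\ |X_2^0\cap X_2^2|,\ |X_2^1\cap X_2^2|\in\{0,1\}$.
   Context: A $k$-regular graph $G$ on $v$ vertices is a $(v,k,\lambda,\mu)$ strongly regular graph if any two distinct adjacent vertices have exactly $\lambda$ common neighbours and any two distinct non-adjacent vertices have exactly $\mu$ common neighbours. -}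

module Defs where

open import Data.Nat using (ℕ)
import Level
open import Data.Fin using (Fin)
open import Data.Fin.Properties using (any?)
import Data.Fin.Properties as FinP
open import Data.List using (length; filter)
open import Data.List.Base using ()
open import Data.Fin.Base using ()
open import Data.List using (List)
open import Data.Product using (_×_; ∃)
open import Relation.Nullary using (¬_; Dec)
open import Relation.Nullary.Decidable using (_×-dec_; ¬?)
open import Relation.Unary using (Pred; Decidable)
open import Relation.Binary.PropositionalEquality using (_≡_; _≢_)
import Data.Nat as ℕ
import Data.List as L
open import Data.Fin using (_≟_)
open import Data.Nat using () renaming (_≟_ to _≟ℕ_)

allFin : (n : ℕ) → List (Fin n)
allFin n = L.tabulate (λ i → i)

card : ∀ {n} {P : Pred (Fin n) Level.zero} → Decidable P → ℕ
card {n} P? = length (filter P? (allFin n))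

record Graph (n : ℕ) : Set₁ where
  field
    Adj    : Fin n → Fin n → Set
    adj?   : ∀ x y → Dec (Adj x y)
    sym    : ∀ {x y} → Adj x y → Adj y x
    irrefl : ∀ {x} → ¬ Adj x x

module _ {n : ℕ} (G : Graph n) where
  open Graph G

  degree : Fin n → ℕ
  degree x = card (adj? x)

  commonNbrs : Fin n → Fin n → ℕ
  commonNbrs x y = card (λ z → adj? x z ×-dec adj? y z)

  IsSRG : (k λ' μ : ℕ) → Set
  IsSRG k λ' μ =
    (∀ x → degree x ≡ k) ×
    (∀ x y → x ≢ y → Adj x y → commonNbrs x y ≡ λ') ×
    (∀ x y → x ≢ y → ¬ Adj x y → commonNbrs x y ≡ μ)

  IsClique : ∀ {m} → (Fin m → Fin n) → Set
  IsClique {m} c = ∀ (i j : Fin m) → i ≢ j → Adj (c i) (c j)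

  _⊆ᶜ_ : ∀ {m m'} → (Fin m → Fin n) → (Fin m' → Fin n) → Set
  c ⊆ᶜ d = ∀ i → ∃ λ j → d j ≡ c i

  module _ {m : ℕ} (K : Fin m → Fin n) where
    InK : Pred (Fin n) Level.zero
    InK v = ∃ λ j → v ≡ K j

    inK? : Decidable InK
    inK? v = any? (λ j → v ≟ K j)

    nbrsInK : Fin n → ℕ
    nbrsInK v = card (λ j → adj? v (K j))

    Xi : ℕ → Pred (Fin n) Level.zero
    Xi i v = (¬ InK v) × (nbrsInK v ≡ i)

    Xi? : (i : ℕ) → Decidable (Xi i)
    Xi? i v = ¬? (inK? v) ×-dec (nbrsInK v ≟ℕ i)

-- Let y be a vertex of X₃. Every vertex v satisfies |N(v) ∩ K| + [v ∈ X₁] ≥ 2 + [v ∈ K],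
-- because X₀ is empty and a vertex of K sees the other three. Summing over the 40
-- neighbours v of y and counting the pairs (v , j) with y ~ v ~ K j the other way round,
-- 2·40 + 3 ≤ (3λ + μ) + |N(y) ∩ X₁| = 56 + |N(y) ∩ X₁|, so y has at least 27 neighbours
-- in X₁. Two vertices of X₃ therefore have at least 27 + 27 − 37 = 17 common neighbours
-- in X₁ and at least 3 + 3 − 4 = 2 in K; as they have at most μ = 20 common neighbours,
-- at most one is left for X₂.
module Submission where

open import Defs
open import Level using (0ℓ)
open import Data.Bool.Base using (true; false; if_then_else_)
open import Data.Nat.Base using (ℕ; zero; suc; _+_; _*_; _∸_; _≤_; z≤n; s≤s; s≤s⁻¹)
open import Data.Nat.Properties
  using ( +-*-semiring; ≤-refl; ≤-reflexive; ≤-trans; ≤-antisym; module ≤-Reasoning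
        ; +-identityʳ; *-identityˡ; *-identityʳ; *-zeroʳ; *-distribʳ-+; m+[n∸m]≡n; 1+n≢n
        ; m≤m+n; m≤n+m; +-mono-≤; +-monoˡ-≤; +-monoʳ-≤; *-monoˡ-≤
        ; +-cancelˡ-≤; +-cancelʳ-≤; +-cancelʳ-≡ )
open import Data.Fin.Base using (Fin; zero; suc)
open import Data.Fin.Properties using (_≟_; 0≢1+n; suc-injective)
open import Data.List.Base using (length; filter; tabulate)
open import Data.Product.Base as Product using (_,_; _×_; ∃; proj₁; proj₂)
open import Data.Sum.Base using ([_,_])
open import Data.Unit.Base using (tt)
open import Function.Base using (_∘_)
open import Relation.Nullary using (Dec; does; yes; no; ¬_; contradiction)
open import Relation.Nullary.Decidable using (¬?; _×-dec_; _⊎-dec_)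
open import Relation.Unary using (Pred; Decidable; _⊆_; _∩_)
open import Relation.Unary.Properties using (_∩?_; _∪?_)
open import Relation.Binary.PropositionalEquality
  using (_≡_; _≢_; refl; sym; trans; cong; cong₂; subst; module ≡-Reasoning)
open import Algebra.Properties.Semiring.Sum +-*-semiring
  using (sum; sum-syntax; sum-cong-≗; ∑-distrib-+; ∑-comm; *-distribˡ-sum; *-distribʳ-sum)

𝟙 : ∀ {p} {P : Set p} → Dec P → ℕ
𝟙 P? = if does P? then 1 else 0

𝟙≤1 : ∀ {p} {P : Set p} (P? : Dec P) → 𝟙 P? ≤ 1
𝟙≤1 (yes _) = s≤s z≤n
𝟙≤1 (no _)  = z≤n

𝟙-mono : ∀ {p q} {P : Set p} {Q : Set q} → (P → Q) → (P? : Dec P) (Q? : Dec Q) → 𝟙 P? ≤ 𝟙 Q?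
𝟙-mono P⇒Q (yes p) (yes _) = ≤-refl
𝟙-mono P⇒Q (yes p) (no ¬q) = contradiction (P⇒Q p) ¬q
𝟙-mono P⇒Q (no _)  _       = z≤n

𝟙-× : ∀ {A B : Set} (A? : Dec A) (B? : Dec B) → 𝟙 (A? ×-dec B?) ≡ 𝟙 A? * 𝟙 B?
𝟙-× (yes _) B? = sym (+-identityʳ (𝟙 B?))
𝟙-× (no _)  B? = refl

sum-mono-≤ : ∀ {n} {f g : Fin n → ℕ} → (∀ i → f i ≤ g i) → sum f ≤ sum g
sum-mono-≤ {zero}  _   = z≤n
sum-mono-≤ {suc n} f≤g = +-mono-≤ (f≤g zero) (sum-mono-≤ (f≤g ∘ suc))

≤-sum : ∀ {n} (f : Fin n → ℕ) i → f i ≤ sum f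
≤-sum f zero    = m≤m+n (f zero) (sum (f ∘ suc))
≤-sum f (suc i) = ≤-trans (≤-sum (f ∘ suc) i) (m≤n+m (sum (f ∘ suc)) (f zero))

∑-const : ∀ n c → ∑[ i < n ] c ≡ n * c
∑-const zero    c = refl
∑-const (suc n) c = cong (c +_) (∑-const n c)

∑-δ : ∀ {n} (w : Fin n) (h : Fin n → ℕ) → ∑[ v < n ] (𝟙 (v ≟ w) * h v) ≡ h w
∑-δ {suc n} zero h = begin
  1 * h zero + ∑[ v < n ] 0  ≡⟨ cong₂ _+_ (*-identityˡ (h zero)) (trans (∑-const n 0) (*-zeroʳ n)) ⟩
  h zero + 0                 ≡⟨ +-identityʳ (h zero) ⟩
  h zero                     ∎
  where open ≡-Reasoning
∑-δ {suc n} (suc w) h = ∑-δ w (h ∘ suc)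

∑𝟙-∅ : ∀ {n} {P : Pred (Fin n) 0ℓ} (P? : Decidable P) → (∀ i → ¬ P i) → ∑[ i < n ] 𝟙 (P? i) ≡ 0
∑𝟙-∅ {zero}  P? ∅ = refl
∑𝟙-∅ {suc n} P? ∅ with P? zero
... | yes p = contradiction p (∅ zero)
... | no _  = ∑𝟙-∅ (P? ∘ suc) (∅ ∘ suc)

∑𝟙-≤1 : ∀ {n} {P : Pred (Fin n) 0ℓ} (P? : Decidable P) → (∀ {i j} → P i → P j → i ≡ j) →
  ∑[ i < n ] 𝟙 (P? i) ≤ 1
∑𝟙-≤1 {zero}  P? unique = z≤n
∑𝟙-≤1 {suc n} P? unique with P? zero
... | yes p = ≤-reflexive (cong suc (∑𝟙-∅ (P? ∘ suc) (λ i pᵢ → 0≢1+n (unique p pᵢ))))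
... | no _  = ∑𝟙-≤1 (P? ∘ suc) (λ pᵢ pⱼ → suc-injective (unique pᵢ pⱼ))

length-filter-tabulate : ∀ {A : Set} {P : Pred A 0ℓ} (P? : Decidable P) {n} (f : Fin n → A) →
  length (filter P? (tabulate f)) ≡ ∑[ i < n ] 𝟙 (P? (f i))
length-filter-tabulate P? {zero}  f = refl
length-filter-tabulate P? {suc n} f with does (P? (f zero))
... | true  = cong suc (length-filter-tabulate P? (f ∘ suc))
... | false = length-filter-tabulate P? (f ∘ suc)

card≡∑ : ∀ {n} {P : Pred (Fin n) 0ℓ} (P? : Decidable P) → card P? ≡ ∑[ i < n ] 𝟙 (P? i)
card≡∑ P? = length-filter-tabulate P? (λ i → i)

card-∩≡∑ : ∀ {n} {P Q : Pred (Fin n) 0ℓ} (P? : Decidable P) (Q? : Decidable Q) →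
  card (P? ∩? Q?) ≡ ∑[ v < n ] (𝟙 (P? v) * 𝟙 (Q? v))
card-∩≡∑ P? Q? = trans (card≡∑ (P? ∩? Q?)) (sum-cong-≗ (λ v → 𝟙-× (P? v) (Q? v)))

card-∅ : ∀ {n} {P : Pred (Fin n) 0ℓ} (P? : Decidable P) → (∀ i → ¬ P i) → card P? ≡ 0
card-∅ P? ∅ = trans (card≡∑ P?) (∑𝟙-∅ P? ∅)

card-pos : ∀ {n} {P : Pred (Fin n) 0ℓ} (P? : Decidable P) → ∀ {i} → P i → 1 ≤ card P?
card-pos P? {i} p rewrite card≡∑ P? =
  ≤-trans (𝟙-mono (λ _ → p) (yes tt) (P? i)) (≤-sum (λ j → 𝟙 (P? j)) i)

card-≤1 : ∀ {n} {P : Pred (Fin n) 0ℓ} (P? : Decidable P) → (∀ {i j} → P i → P j → i ≡ j) → card P? ≤ 1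
card-≤1 P? unique rewrite card≡∑ P? = ∑𝟙-≤1 P? unique

card-mono : ∀ {n} {P Q : Pred (Fin n) 0ℓ} (P? : Decidable P) (Q? : Decidable Q) → P ⊆ Q → card P? ≤ card Q?
card-mono P? Q? P⊆Q rewrite card≡∑ P? | card≡∑ Q? = sum-mono-≤ (λ i → 𝟙-mono P⊆Q (P? i) (Q? i))

card-cong : ∀ {n} {P Q : Pred (Fin n) 0ℓ} (P? : Decidable P) (Q? : Decidable Q) →
  P ⊆ Q → Q ⊆ P → card P? ≡ card Q?
card-cong P? Q? P⊆Q Q⊆P = ≤-antisym (card-mono P? Q? P⊆Q) (card-mono Q? P? Q⊆P)

card≤n : ∀ {n} {P : Pred (Fin n) 0ℓ} (P? : Decidable P) → card P? ≤ n
card≤n {n} P? rewrite card≡∑ P? = begin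
  ∑[ i < n ] 𝟙 (P? i)  ≤⟨ sum-mono-≤ (λ i → 𝟙≤1 (P? i)) ⟩
  ∑[ i < n ] 1         ≡⟨ ∑-const n 1 ⟩
  n * 1                ≡⟨ *-identityʳ n ⟩
  n                    ∎
  where open ≤-Reasoning

card-∁ : ∀ {n} {P : Pred (Fin n) 0ℓ} (P? : Decidable P) → card P? + card (¬? ∘ P?) ≡ n
card-∁ {n} P? rewrite card≡∑ P? | card≡∑ (¬? ∘ P?) = begin
  ∑[ i < n ] 𝟙 (P? i) + ∑[ i < n ] 𝟙 (¬? (P? i))  ≡⟨ ∑-distrib-+ (λ i → 𝟙 (P? i)) (λ i → 𝟙 (¬? (P? i))) ⟨
  ∑[ i < n ] (𝟙 (P? i) + 𝟙 (¬? (P? i)))           ≡⟨ sum-cong-≗ (λ i → 𝟙+𝟙¬ (P? i)) ⟩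
  ∑[ i < n ] 1                                     ≡⟨ ∑-const n 1 ⟩
  n * 1                                            ≡⟨ *-identityʳ n ⟩
  n                                                ∎
  where
  open ≡-Reasoning
  𝟙+𝟙¬ : ∀ {A : Set} (A? : Dec A) → 𝟙 A? + 𝟙 (¬? A?) ≡ 1
  𝟙+𝟙¬ (yes _) = refl
  𝟙+𝟙¬ (no _)  = refl

card-∪+card-∩ : ∀ {n} {P Q : Pred (Fin n) 0ℓ} (P? : Decidable P) (Q? : Decidable Q) →
  card (P? ∪? Q?) + card (P? ∩? Q?) ≡ card P? + card Q?
card-∪+card-∩ {n} P? Q? rewrite card≡∑ (P? ∪? Q?) | card≡∑ (P? ∩? Q?) | card≡∑ P? | card≡∑ Q? = begin
  ∑[ i < n ] 𝟙 ((P? ∪? Q?) i) + ∑[ i < n ] 𝟙 ((P? ∩? Q?) i)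
    ≡⟨ ∑-distrib-+ (λ i → 𝟙 ((P? ∪? Q?) i)) (λ i → 𝟙 ((P? ∩? Q?) i)) ⟨
  ∑[ i < n ] (𝟙 ((P? ∪? Q?) i) + 𝟙 ((P? ∩? Q?) i))
    ≡⟨ sum-cong-≗ (λ i → 𝟙∪+𝟙∩ (P? i) (Q? i)) ⟩
  ∑[ i < n ] (𝟙 (P? i) + 𝟙 (Q? i))
    ≡⟨ ∑-distrib-+ (λ i → 𝟙 (P? i)) (λ i → 𝟙 (Q? i)) ⟩
  ∑[ i < n ] 𝟙 (P? i) + ∑[ i < n ] 𝟙 (Q? i)
    ∎
  where
  open ≡-Reasoning
  𝟙∪+𝟙∩ : ∀ {A B : Set} (A? : Dec A) (B? : Dec B) → 𝟙 (A? ⊎-dec B?) + 𝟙 (A? ×-dec B?) ≡ 𝟙 A? + 𝟙 B?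
  𝟙∪+𝟙∩ (yes _) (yes _) = refl
  𝟙∪+𝟙∩ (yes _) (no _)  = refl
  𝟙∪+𝟙∩ (no _)  (yes _) = refl
  𝟙∪+𝟙∩ (no _)  (no _)  = refl

card-∪-disjoint : ∀ {n} {P Q : Pred (Fin n) 0ℓ} (P? : Decidable P) (Q? : Decidable Q) →
  (∀ {v} → P v → ¬ Q v) → card (P? ∪? Q?) ≡ card P? + card Q?
card-∪-disjoint P? Q? disjoint = begin
  card (P? ∪? Q?)                    ≡⟨ +-identityʳ (card (P? ∪? Q?)) ⟨
  card (P? ∪? Q?) + 0                ≡⟨ cong (card (P? ∪? Q?) +_) (card-∅ (P? ∩? Q?) (λ _ (p , q) → disjoint p q)) ⟨
  card (P? ∪? Q?) + card (P? ∩? Q?)  ≡⟨ card-∪+card-∩ P? Q? ⟩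
  card P? + card Q?                  ∎
  where open ≡-Reasoning

card+card≤n+card-∩ : ∀ {n} {P Q : Pred (Fin n) 0ℓ} (P? : Decidable P) (Q? : Decidable Q) →
  card P? + card Q? ≤ n + card (P? ∩? Q?)
card+card≤n+card-∩ {n} P? Q? = subst (_≤ n + card (P? ∩? Q?)) (card-∪+card-∩ P? Q?)
  (+-monoˡ-≤ (card (P? ∩? Q?)) (card≤n (P? ∪? Q?)))

card-∩+card-∩≤ : ∀ {n} {P Q R : Pred (Fin n) 0ℓ} (P? : Decidable P) (Q? : Decidable Q) (R? : Decidable R) →
  card (P? ∩? Q?) + card (P? ∩? R?) ≤ card P? + card (P? ∩? (Q? ∩? R?))
card-∩+card-∩≤ P? Q? R? = subst (_≤ card P? + card (P? ∩? (Q? ∩? R?))) (card-∪+card-∩ (P? ∩? Q?) (P? ∩? R?))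
  (+-mono-≤ (card-mono ((P? ∩? Q?) ∪? (P? ∩? R?)) P? [ proj₁ , proj₁ ])
            (card-mono ((P? ∩? Q?) ∩? (P? ∩? R?)) (P? ∩? (Q? ∩? R?)) (λ ((p , q) , (_ , r)) → p , q , r)))

card-≤-injection : ∀ {m n} {P : Pred (Fin m) 0ℓ} {Q : Pred (Fin n) 0ℓ}
  (P? : Decidable P) (Q? : Decidable Q) {f : Fin m → Fin n} →
  (∀ {i j} → f i ≡ f j → i ≡ j) → (∀ {i} → P i → Q (f i)) → card P? ≤ card Q?
card-≤-injection {m} {n} P? Q? {f} f-injective P⇒Q rewrite card≡∑ P? | card≡∑ Q? = begin
  ∑[ i < m ] 𝟙 (P? i)                                ≤⟨ sum-mono-≤ (λ i → 𝟙-mono P⇒Q (P? i) (Q? (f i))) ⟩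
  ∑[ i < m ] 𝟙 (Q? (f i))                            ≡⟨ sum-cong-≗ (λ i → ∑-δ (f i) (λ v → 𝟙 (Q? v))) ⟨
  ∑[ i < m ] ∑[ v < n ] (𝟙 (v ≟ f i) * 𝟙 (Q? v))    ≡⟨ ∑-comm (λ i v → 𝟙 (v ≟ f i) * 𝟙 (Q? v)) ⟩
  ∑[ v < n ] ∑[ i < m ] (𝟙 (v ≟ f i) * 𝟙 (Q? v))    ≡⟨ sum-cong-≗ (λ v → *-distribʳ-sum (𝟙 (Q? v)) (λ i → 𝟙 (v ≟ f i))) ⟨
  ∑[ v < n ] ((∑[ i < m ] 𝟙 (v ≟ f i)) * 𝟙 (Q? v))  ≤⟨ sum-mono-≤ (λ v → *-monoˡ-≤ (𝟙 (Q? v)) (fibre≤1 v)) ⟩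
  ∑[ v < n ] (1 * 𝟙 (Q? v))                          ≡⟨ sum-cong-≗ (λ v → *-identityˡ (𝟙 (Q? v))) ⟩
  ∑[ v < n ] 𝟙 (Q? v)                                ∎
  where
  open ≤-Reasoning
  fibre≤1 : ∀ v → ∑[ i < m ] 𝟙 (v ≟ f i) ≤ 1
  fibre≤1 v = ∑𝟙-≤1 (λ i → v ≟ f i) (λ v≡fᵢ v≡fⱼ → f-injective (trans (sym v≡fᵢ) v≡fⱼ))

∑-card*𝟙 : ∀ {m n} {P : Pred (Fin n) 0ℓ} {R : Fin n → Pred (Fin m) 0ℓ}
  (R? : ∀ v → Decidable (R v)) (P? : Decidable P) →
  ∑[ v < n ] (card (R? v) * 𝟙 (P? v)) ≡ ∑[ j < m ] card (λ v → R? v j ×-dec P? v)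
∑-card*𝟙 {m} {n} R? P? = begin
  ∑[ v < n ] (card (R? v) * 𝟙 (P? v))              ≡⟨ sum-cong-≗ (λ v → cong (_* 𝟙 (P? v)) (card≡∑ (R? v))) ⟩
  ∑[ v < n ] ((∑[ j < m ] 𝟙 (R? v j)) * 𝟙 (P? v))  ≡⟨ sum-cong-≗ (λ v → *-distribʳ-sum (𝟙 (P? v)) (λ j → 𝟙 (R? v j))) ⟩
  ∑[ v < n ] ∑[ j < m ] (𝟙 (R? v j) * 𝟙 (P? v))    ≡⟨ ∑-comm (λ v j → 𝟙 (R? v j) * 𝟙 (P? v)) ⟩
  ∑[ j < m ] ∑[ v < n ] (𝟙 (R? v j) * 𝟙 (P? v))    ≡⟨ sum-cong-≗ (λ j → card-∩≡∑ (λ v → R? v j) P?) ⟨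
  ∑[ j < m ] card (λ v → R? v j ×-dec P? v)        ∎
  where open ≡-Reasoning

module _ {n : ℕ} (G : Graph n) where
  open Graph G using (Adj; adj?; irrefl) renaming (sym to Adj-sym)

  clique-injective : ∀ {m} {K : Fin m → Fin n} → IsClique G K → ∀ {i j} → K i ≡ K j → i ≡ j
  clique-injective {K = K} clique {i} {j} Kᵢ≡Kⱼ with i ≟ j
  ... | yes i≡j = i≡j
  ... | no i≢j  = contradiction (subst (Adj (K i)) (sym Kᵢ≡Kⱼ) (clique i j i≢j)) irrefl

  commonNbrs≤μ : ∀ {k λ' μ} → IsSRG G k λ' μ → λ' ≤ μ → ∀ {x y} → x ≢ y → commonNbrs G x y ≤ μ
  commonNbrs≤μ (_ , adjacent , nonadjacent) λ'≤μ {x} {y} x≢y with adj? x y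
  ... | yes x~y = ≤-trans (≤-reflexive (adjacent x y x≢y x~y)) λ'≤μ
  ... | no x≁y  = ≤-reflexive (nonadjacent x y x≢y x≁y)

  ∑-commonNbrs+nbrsInK : ∀ {k λ' μ} → IsSRG G k λ' μ → λ' ≤ μ →
    ∀ {m} (K : Fin m → Fin n) {y} → ¬ InK G K y →
    ∑[ j < m ] commonNbrs G y (K j) + (μ ∸ λ') * nbrsInK G K y ≡ m * μ
  ∑-commonNbrs+nbrsInK {λ' = λ'} {μ} (_ , adjacent , nonadjacent) λ'≤μ {m} K {y} y∉K = begin
    ∑[ j < m ] c j + (μ ∸ λ') * nbrsInK G K y     ≡⟨ cong (λ t → ∑[ j < m ] c j + (μ ∸ λ') * t) (card≡∑ (λ j → adj? y (K j))) ⟩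
    ∑[ j < m ] c j + (μ ∸ λ') * ∑[ j < m ] a j    ≡⟨ cong (∑[ j < m ] c j +_) (*-distribˡ-sum (μ ∸ λ') a) ⟩
    ∑[ j < m ] c j + ∑[ j < m ] ((μ ∸ λ') * a j)  ≡⟨ ∑-distrib-+ c (λ j → (μ ∸ λ') * a j) ⟨
    ∑[ j < m ] (c j + (μ ∸ λ') * a j)             ≡⟨ sum-cong-≗ c+[μ∸λ]a≡μ ⟩
    ∑[ j < m ] μ                                  ≡⟨ ∑-const m μ ⟩
    m * μ                                         ∎
    where
    open ≡-Reasoning
    c a : Fin m → ℕ
    c j = commonNbrs G y (K j)
    a j = 𝟙 (adj? y (K j))
    c+[μ∸λ]a≡μ : ∀ j → c j + (μ ∸ λ') * a j ≡ μ
    c+[μ∸λ]a≡μ j with adj? y (K j)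
    ... | yes y~Kⱼ = trans (cong₂ _+_ (adjacent y (K j) (λ eq → y∉K (j , eq)) y~Kⱼ) (*-identityʳ (μ ∸ λ')))
                           (m+[n∸m]≡n λ'≤μ)
    ... | no y≁Kⱼ  = trans (cong₂ _+_ (nonadjacent y (K j) (λ eq → y∉K (j , eq)) y≁Kⱼ) (*-zeroʳ (μ ∸ λ')))
                           (+-identityʳ μ)

  card-X₁+card-X₂+card-inK≤ : ∀ {m} (K : Fin m → Fin n) {S : Pred (Fin n) 0ℓ} (S? : Decidable S) →
    card (Xi? G K 1 ∩? S?) + card (Xi? G K 2 ∩? S?) + card (inK? G K ∩? S?) ≤ card S?
  card-X₁+card-X₂+card-inK≤ K {S} S? = begin
    card X₁S + card X₂S + card KS  ≡⟨ cong (_+ card KS) (card-∪-disjoint X₁S X₂S X₁∩X₂=∅) ⟨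
    card (X₁S ∪? X₂S) + card KS    ≡⟨ card-∪-disjoint (X₁S ∪? X₂S) KS [ outside-K , outside-K ] ⟨
    card ((X₁S ∪? X₂S) ∪? KS)      ≤⟨ card-mono ((X₁S ∪? X₂S) ∪? KS) S? [ [ proj₂ , proj₂ ] , proj₂ ] ⟩
    card S?                        ∎
    where
    open ≤-Reasoning
    X₁S : Decidable (Xi G K 1 ∩ S)
    X₁S = Xi? G K 1 ∩? S?
    X₂S : Decidable (Xi G K 2 ∩ S)
    X₂S = Xi? G K 2 ∩? S?
    KS : Decidable (InK G K ∩ S)
    KS = inK? G K ∩? S?
    X₁∩X₂=∅ : ∀ {v} → (Xi G K 1 ∩ S) v → ¬ (Xi G K 2 ∩ S) v
    X₁∩X₂=∅ ((_ , sees-1) , _) ((_ , sees-2) , _) = 1+n≢n (trans (sym sees-2) sees-1)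
    outside-K : ∀ {i v} → (Xi G K i ∩ S) v → ¬ (InK G K ∩ S) v
    outside-K ((v∉K , _) , _) (v∈K , _) = v∉K v∈K

  module _ {m : ℕ} {K : Fin m → Fin n} (clique : IsClique G K) where

    m≤1+nbrsInK : ∀ j → m ≤ suc (nbrsInK G K (K j))
    m≤1+nbrsInK j = begin
      m                                      ≡⟨ card-∁ (_≟ j) ⟨
      card (_≟ j) + card (λ i → ¬? (i ≟ j))  ≤⟨ +-mono-≤ (card-≤1 (_≟ j) (λ i≡j i′≡j → trans i≡j (sym i′≡j)))
                                                         (card-mono (λ i → ¬? (i ≟ j)) (λ i → adj? (K j) (K i))
                                                                    (λ i≢j → clique j _ (i≢j ∘ sym))) ⟩
      1 + nbrsInK G K (K j)                  ∎
      where open ≤-Reasoning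

    card-∘K≤card-inK : ∀ {Q : Pred (Fin n) 0ℓ} (Q? : Decidable Q) → card (Q? ∘ K) ≤ card (inK? G K ∩? Q?)
    card-∘K≤card-inK Q? =
      card-≤-injection (Q? ∘ K) (inK? G K ∩? Q?) (clique-injective clique) (λ {j} q → (j , refl) , q)

    2+𝟙-inK≤ : card (Xi? G K 0) ≡ 0 → 4 ≤ m →
      ∀ v → 2 + 𝟙 (inK? G K v) ≤ nbrsInK G K v + 𝟙 (Xi? G K 1 v)
    2+𝟙-inK≤ X₀-empty 4≤m v with inK? G K v
    ... | yes (j , refl) = ≤-trans (s≤s⁻¹ (≤-trans 4≤m (m≤1+nbrsInK j))) (m≤m+n _ _)
    ... | no v∉K with nbrsInK G K v in sees
    ...   | zero        = contradiction (subst (1 ≤_) X₀-empty (card-pos (Xi? G K 0) (v∉K , sees))) λ ()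
    -- abstracting nbrsInK G K v also turns Xi? G K 1 v into a decided instance of 1 ≟ 1
    ...   | suc zero    = ≤-refl
    ...   | suc (suc _) = m≤m+n _ _

    ∑-nbrsInK*adj : ∀ y → ∑[ v < n ] (nbrsInK G K v * 𝟙 (adj? y v)) ≡ ∑[ j < m ] commonNbrs G y (K j)
    ∑-nbrsInK*adj y = trans (∑-card*𝟙 (λ v j → adj? v (K j)) (adj? y))
      (sum-cong-≗ (λ j → card-cong (λ v → adj? v (K j) ×-dec adj? y v) (λ v → adj? y v ×-dec adj? (K j) v)
        (λ (v~Kⱼ , y~v) → y~v , Adj-sym v~Kⱼ) (λ (y~v , Kⱼ~v) → Adj-sym Kⱼ~v , y~v)))

    2*degree+card-inK≤ : card (Xi? G K 0) ≡ 0 → 4 ≤ m → ∀ y →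
      2 * degree G y + card (inK? G K ∩? adj? y) ≤ ∑[ j < m ] commonNbrs G y (K j) + card (Xi? G K 1 ∩? adj? y)
    2*degree+card-inK≤ X₀-empty 4≤m y = begin
      2 * degree G y + card (inK? G K ∩? adj? y)
        ≡⟨ cong₂ _+_ (cong (2 *_) (card≡∑ (adj? y))) (card-∩≡∑ (inK? G K) (adj? y)) ⟩
      2 * ∑[ v < n ] a v + ∑[ v < n ] (𝟙 (inK? G K v) * a v)
        ≡⟨ cong (_+ ∑[ v < n ] (𝟙 (inK? G K v) * a v)) (*-distribˡ-sum 2 a) ⟩
      ∑[ v < n ] (2 * a v) + ∑[ v < n ] (𝟙 (inK? G K v) * a v)
        ≡⟨ ∑-distrib-+ (λ v → 2 * a v) (λ v → 𝟙 (inK? G K v) * a v) ⟨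
      ∑[ v < n ] (2 * a v + 𝟙 (inK? G K v) * a v)
        ≡⟨ sum-cong-≗ (λ v → *-distribʳ-+ (a v) 2 (𝟙 (inK? G K v))) ⟨
      ∑[ v < n ] ((2 + 𝟙 (inK? G K v)) * a v)
        ≤⟨ sum-mono-≤ (λ v → *-monoˡ-≤ (a v) (2+𝟙-inK≤ X₀-empty 4≤m v)) ⟩
      ∑[ v < n ] ((nbrsInK G K v + 𝟙 (Xi? G K 1 v)) * a v)
        ≡⟨ sum-cong-≗ (λ v → *-distribʳ-+ (a v) (nbrsInK G K v) (𝟙 (Xi? G K 1 v))) ⟩
      ∑[ v < n ] (nbrsInK G K v * a v + 𝟙 (Xi? G K 1 v) * a v)
        ≡⟨ ∑-distrib-+ (λ v → nbrsInK G K v * a v) (λ v → 𝟙 (Xi? G K 1 v) * a v) ⟩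
      ∑[ v < n ] (nbrsInK G K v * a v) + ∑[ v < n ] (𝟙 (Xi? G K 1 v) * a v)
        ≡⟨ cong₂ _+_ (∑-nbrsInK*adj y) (sym (card-∩≡∑ (Xi? G K 1) (adj? y))) ⟩
      ∑[ j < m ] commonNbrs G y (K j) + card (Xi? G K 1 ∩? adj? y)
        ∎
      where
      open ≤-Reasoning
      a : Fin n → ℕ
      a v = 𝟙 (adj? y v)

module _ (X : Graph 95) (srg : IsSRG X 40 12 20) {K : Fin 4 → Fin 95} (clique : IsClique X K)
         (X₀-empty : card (Xi? X K 0) ≡ 0) (X₁-size : card (Xi? X K 1) ≡ 37) where
  open Graph X using (Adj; adj?)

  27≤card-X₁∩adj : ∀ {y} → Xi X K 3 y → 27 ≤ card (Xi? X K 1 ∩? adj? y)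
  27≤card-X₁∩adj {y} (y∉K , y-sees-3) = +-cancelˡ-≤ 56 27 (card (Xi? X K 1 ∩? adj? y)) (begin
    2 * 40 + 3                                                    ≡⟨ cong₂ (λ d t → 2 * d + t) (proj₁ srg y) y-sees-3 ⟨
    2 * degree X y + nbrsInK X K y                                ≤⟨ +-monoʳ-≤ (2 * degree X y) (card-∘K≤card-inK X clique (adj? y)) ⟩
    2 * degree X y + card (inK? X K ∩? adj? y)                    ≤⟨ 2*degree+card-inK≤ X clique X₀-empty ≤-refl y ⟩
    ∑[ j < 4 ] commonNbrs X y (K j) + card (Xi? X K 1 ∩? adj? y)  ≡⟨ cong (_+ card (Xi? X K 1 ∩? adj? y)) ∑-commonNbrs≡56 ⟩
    56 + card (Xi? X K 1 ∩? adj? y)                               ∎)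
    where
    open ≤-Reasoning
    ∑-commonNbrs≡56 : ∑[ j < 4 ] commonNbrs X y (K j) ≡ 56
    ∑-commonNbrs≡56 = +-cancelʳ-≡ 24 (∑[ j < 4 ] commonNbrs X y (K j)) 56
      (trans (cong (λ t → ∑[ j < 4 ] commonNbrs X y (K j) + 8 * t) (sym y-sees-3))
             (∑-commonNbrs+nbrsInK X srg (m≤m+n 12 8) K y∉K))

  card-X₂∩common≤1 : ∀ {y y′} → Xi X K 3 y → Xi X K 3 y′ → y ≢ y′ →
    card ((Xi? X K 2 ∩? adj? y) ∩? adj? y′) ≤ 1
  card-X₂∩common≤1 {y} {y′} y∈X₃@(_ , y-sees-3) y′∈X₃@(_ , y′-sees-3) y≢y′ = begin
    card ((Xi? X K 2 ∩? adj? y) ∩? adj? y′)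
      ≡⟨ card-cong ((Xi? X K 2 ∩? adj? y) ∩? adj? y′) (Xi? X K 2 ∩? C) Product.assocʳ′ Product.assocˡ′ ⟩
    c₂
      ≤⟨ +-cancelˡ-≤ 17 c₂ 1 (+-cancelʳ-≤ 2 (17 + c₂) 18 17+c₂+2≤20) ⟩
    1 ∎
    where
    open ≤-Reasoning
    C : Decidable (Adj y ∩ Adj y′)
    C = adj? y ∩? adj? y′
    c₁ c₂ cK : ℕ
    c₁ = card (Xi? X K 1 ∩? C)
    c₂ = card (Xi? X K 2 ∩? C)
    cK = card (inK? X K ∩? C)
    17≤c₁ : 17 ≤ c₁
    17≤c₁ = +-cancelˡ-≤ 37 17 c₁ (begin
      27 + 27                                                   ≤⟨ +-mono-≤ (27≤card-X₁∩adj y∈X₃) (27≤card-X₁∩adj y′∈X₃) ⟩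
      card (Xi? X K 1 ∩? adj? y) + card (Xi? X K 1 ∩? adj? y′)  ≤⟨ card-∩+card-∩≤ (Xi? X K 1) (adj? y) (adj? y′) ⟩
      card (Xi? X K 1) + c₁                                     ≡⟨ cong (_+ c₁) X₁-size ⟩
      37 + c₁                                                   ∎)
    2≤cK : 2 ≤ cK
    2≤cK = +-cancelˡ-≤ 4 2 cK (begin
      3 + 3                           ≡⟨ cong₂ _+_ y-sees-3 y′-sees-3 ⟨
      nbrsInK X K y + nbrsInK X K y′  ≤⟨ card+card≤n+card-∩ (λ j → adj? y (K j)) (λ j → adj? y′ (K j)) ⟩
      4 + card (C ∘ K)                ≤⟨ +-monoʳ-≤ 4 (card-∘K≤card-inK X clique C) ⟩
      4 + cK                          ∎)
    17+c₂+2≤20 : 17 + c₂ + 2 ≤ 18 + 2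
    17+c₂+2≤20 = begin
      17 + c₂ + 2        ≤⟨ +-mono-≤ (+-monoˡ-≤ c₂ 17≤c₁) 2≤cK ⟩
      c₁ + c₂ + cK       ≤⟨ card-X₁+card-X₂+card-inK≤ X K C ⟩
      commonNbrs X y y′  ≤⟨ commonNbrs≤μ X srg (m≤m+n 12 8) y≢y′ ⟩
      20                 ∎

lemma17 : (X : Graph 95) → IsSRG X 40 12 20 →
    (K : Fin 4 → Fin 95) → IsClique X K →
    ¬ (∃ λ (C : Fin 5 → Fin 95) → IsClique X C × _⊆ᶜ_ X K C) →
    card (Xi? X K 0) ≡ 0 → card (Xi? X K 1) ≡ 37 →
    card (Xi? X K 2) ≡ 51 → card (Xi? X K 3) ≡ 3 →
    (x : Fin 3 → Fin 95) → (∀ a b → x a ≡ x b → a ≡ b) →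
    (∀ v → Xi X K 3 v → ∃ λ a → x a ≡ v) →
    (∀ a → Xi X K 3 (x a)) →
    ∀ (a b : Fin 3) → a ≢ b →
    card (λ v → (Xi? X K 2 v ×-dec Graph.adj? X (x a) v) ×-dec Graph.adj? X (x b) v) ≤ 1
lemma17 X srg K clique _ X₀-empty X₁-size _ _ x x-injective _ x∈X₃ a b a≢b =
  card-X₂∩common≤1 X srg clique X₀-empty X₁-size (x∈X₃ a) (x∈X₃ b) (a≢b ∘ x-injective a b)
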